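{- Let $k\in\mathbb{N}$. The set of $\mathcal{P}$-positions of the game $\Gamma_k$ is exactly $P_k=P_{k,0}\cup P_{k,1}\cup P_{k,2}$, where $P_{k,0}=\{(x,y)\in\mathbb{Z}_{\ge0}^2: x+y\le k\}$, $P_{k,1}=\{(b_n,a_n):n\in\mathbb{N}\}$ and $P_{k,2}=\{(a_n,b_n):n\in\mathbb{N}\}$.
   Context: For $k\in\mathbb{N}$, the game $\Gamma_k$ (a variant of Wythoff's game) is a two-player impartial game whose positions are pairs $(x,y)\in\mathbb{Z}_{\ge0}^2$. From a position $(x,y)\notin T_k$, where $T_k=\{(x,y): x+y\le k\}$, a move goes to any of: $(u,y)$ with $0\le u<x$; $(x,v)$ with $0\le v<y$; $(x-t,y-t)$ with $1\le t\le\min(x,y)$. Positions in $T_k$ have no moves. Players alternate; a player who cannot move loses (equivalently, the player who moves into $T_k$ wins). A $\mathcal{P}$-position is a position from which the previous player can force a win (equivalently, Grundy number $0$). Let $\sigma$ be the substitution on finite lists over $\{1,2\}$ acting letterwise by $\sigma(1)=2$, $\sigma(2)=2,1$. Let $C_{1,1}=(1)$ and $C_{i+1,1}=\sigma(C_{i,1})$. Let $C_i^{(k)}$ be the concatenation of $k$ copies of $C_{i,1}$, let $(c_n)_{n\in\mathbb{N}}$ be the infinite sequence obtained by concatenating $C_1^{(k)},C_2^{(k)},C_3^{(k)},\dots$ in this order, and $d_n=c_n+1$. Define $a_n=(k+1)+\sum_{i=1}^{n-1}c_i$ and $b_n=(2k+2)+\sum_{i=1}^{n-1}d_i$ for $n\in\mathbb{N}$.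 -}

module Defs where

open import Data.Nat using (ℕ; zero; suc; _+_; _∸_; _≤_; _<_)
open import Data.List using (List; []; _∷_; _++_; concat; replicate; concatMap)
open import Data.Product using (_×_; Σ; _,_)
open import Data.Sum using (_⊎_)

data Move (k : ℕ) : ℕ → ℕ → ℕ → ℕ → Set where
  left  : ∀ {x y u} → k < x + y → u < x → Move k x y u y
  down  : ∀ {x y v} → k < x + y → v < y → Move k x y x v
  diag  : ∀ {x y t} → k < x + y → 1 ≤ t → t ≤ x → t ≤ y →
          Move k x y (x ∸ t) (y ∸ t)

-- P-positions (previous player wins) and N-positions (next player wins),
-- defined by the usual inductive characterisation for a finite
-- (well-founded) game under normal play.
data IsP (k : ℕ) (x y : ℕ) : Set
data IsN (k : ℕ) (x y : ℕ) : Set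

data IsP k x y where
  allMovesToN : (∀ u v → Move k x y u v → IsN k u v) → IsP k x y

data IsN k x y where
  moveToP : ∀ u v → Move k x y u v → IsP k u v → IsN k x y

σ : List ℕ → List ℕ
σ [] = []
σ (1 ∷ w) = 2 ∷ σ w
σ (_ ∷ w) = 2 ∷ 1 ∷ σ w

-- C i,1 with i ≥ 1 (C 1 = (1)); we index Cw m = C_{m+1,1}
Cw : ℕ → List ℕ
Cw zero = 1 ∷ []
Cw (suc m) = σ (Cw m)

block : ℕ → ℕ → List ℕ
block k m = concat (replicate k (Cw m))

prefix : ℕ → ℕ → List ℕ
prefix k zero = []
prefix k (suc m) = prefix k m ++ block k m

nth : List ℕ → ℕ → ℕ
nth [] _ = 0
nth (x ∷ _) zero = x
nth (_ ∷ xs) (suc i) = nth xs i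

-- c k n = c_n (1-based, n ≥ 1). For k ≥ 1 each block is nonempty, so
-- prefix k n has length ≥ n and already contains c_n.
c : ℕ → ℕ → ℕ
c k n = nth (prefix k n) (n ∸ 1)

d : ℕ → ℕ → ℕ
d k n = suc (c k n)

sumTo : (ℕ → ℕ) → ℕ → ℕ
sumTo f zero = 0
sumTo f (suc m) = sumTo f m + f (suc m)

a : ℕ → ℕ → ℕ
a k n = suc k + sumTo (c k) (n ∸ 1)

b : ℕ → ℕ → ℕ
b k n = (2 + 2 * k) + sumTo (d k) (n ∸ 1)
  where open import Data.Nat using (_*_)

Pk : ℕ → ℕ → ℕ → Set
Pk k x y = (x + y ≤ k)
         ⊎ (Σ ℕ λ n → 1 ≤ n × x ≡ b k n × y ≡ a k n)
         ⊎ (Σ ℕ λ n → 1 ≤ n × x ≡ a k n × y ≡ b k n)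
  where open import Relation.Binary.PropositionalEquality using (_≡_)

{-# OPTIONS --safe #-}
-- The word c satisfies c = 1ᵏ σ(c) and has letters in {1, 2}, so a is increasing with
-- steps c_n, and b_n = a_n + k + n. The image under σ of the j-th letter of c begins
-- with a 2, at an index p with a_p + 1 = b_j; conversely every 2 in σ(c) arises this
-- way. Hence the b_j are exactly the integers skipped by a, and {a_n}, {b_n} partition
-- the integers > k. Then P_k is a kernel of the move graph: no move joins two of its
-- positions (a and b are injective with disjoint ranges, and the differences
-- b_n - a_n = k + n are distinct), and from any other position there is a move into
-- T_k or onto a pair (a_n, b_n), as in Wythoff's game.
module Submission where

open import Defs
open import Data.Nat using (ℕ; zero; suc; _+_; _*_; _∸_; _≤_; _<_; z≤n; s≤s; _≤?_; _<?_)
open import Data.Nat.Properties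
open import Data.Nat.Induction using (<-wellFounded)
open import Data.Nat.ListAction using (sum)
open import Data.Nat.ListAction.Properties using (sum-++)
open import Data.Nat.Tactic.RingSolver using (solve-∀)
open import Algebra.Properties.CommutativeSemigroup +-commutativeSemigroup using (x∙yz≈y∙xz; xy∙z≈xz∙y)
open import Data.List using (List; []; _∷_; _++_; concat; replicate; length)
open import Data.List.Properties using (length-++; length-replicate; ++-assoc; ++-identityʳ)
open import Data.List.Relation.Unary.All using (All; []; _∷_)
open import Data.List.Relation.Unary.All.Properties using (++⁺; ++⁻ˡ; replicate⁺)
open import Data.Product as Product using (∃-syntax; _×_; _,_)
open import Data.Sum as Sum using (_⊎_; inj₁; inj₂)
open import Induction.WellFounded using (Acc; acc)
open import Relation.Nullary using (¬_; yes; no; contradiction)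
open import Relation.Binary.Definitions using (tri<; tri≈; tri>)
open import Relation.Binary.PropositionalEquality
open import Function.Bundles using (_⇔_; mk⇔)
open import Function.Properties.Equivalence using () renaming (trans to ⇔-trans)

Is12 : ℕ → Set
Is12 x = x ≡ 1 ⊎ x ≡ 2

nth-++ˡ : ∀ xs ys {i} → i < length xs → nth (xs ++ ys) i ≡ nth xs i
nth-++ˡ (x ∷ xs) ys {zero}  _          = refl
nth-++ˡ (x ∷ xs) ys {suc i} (s≤s i<n) = nth-++ˡ xs ys i<n

nth-++ʳ : ∀ xs ys j → nth (xs ++ ys) (length xs + j) ≡ nth ys j
nth-++ʳ []       ys j = refl
nth-++ʳ (x ∷ xs) ys j = nth-++ʳ xs ys j

nth-length : ∀ xs y ys → nth (xs ++ y ∷ ys) (length xs) ≡ y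
nth-length []       y ys = refl
nth-length (x ∷ xs) y ys = nth-length xs y ys

All-nth : ∀ {P : ℕ → Set} {xs i} → All P xs → i < length xs → P (nth xs i)
All-nth {i = zero}  (px ∷ pxs) _         = px
All-nth {i = suc i} (px ∷ pxs) (s≤s i<n) = All-nth pxs i<n

split-at : ∀ {A : Set} {j} (xs : List A) → j < length xs →
           ∃[ ys ] ∃[ x ] ∃[ zs ] ys ++ x ∷ zs ≡ xs × length ys ≡ j
split-at {j = zero}  (x ∷ xs) _ = [] , x , xs , refl , refl
split-at {j = suc j} (y ∷ xs) (s≤s j<n) with split-at xs j<n
... | ys , x , zs , eq , len = y ∷ ys , x , zs , cong (y ∷_) eq , cong suc len

sum-replicate : ∀ n x → sum (replicate n x) ≡ n * x
sum-replicate zero    x = refl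
sum-replicate (suc n) x = cong (x +_) (sum-replicate n x)

sumTo-suc : ∀ f n → sumTo (λ i → suc (f i)) n ≡ sumTo f n + n
sumTo-suc f zero    = refl
sumTo-suc f (suc n) = trans (cong (_+ suc (f (suc n))) (sumTo-suc f n)) (rearrange (sumTo f n) n (f (suc n)))
  where
  rearrange : ∀ s n x → s + n + suc x ≡ s + x + suc n
  rearrange = solve-∀

sumTo-unshift : ∀ f n → sumTo f (suc n) ≡ f 1 + sumTo (λ i → f (suc i)) n
sumTo-unshift f zero    = +-comm 0 (f 1)
sumTo-unshift f (suc n) = trans (cong (_+ f (2 + n)) (sumTo-unshift f n)) (+-assoc (f 1) _ _)

sumTo-nth : ∀ f xs → (∀ {i} → i < length xs → nth xs i ≡ f (suc i)) → sumTo f (length xs) ≡ sum xs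
sumTo-nth f []       _     = refl
sumTo-nth f (x ∷ xs) xs≗f = trans (sumTo-unshift f (length xs))
  (cong₂ _+_ (sym (xs≗f (s≤s z≤n))) (sumTo-nth (λ i → f (suc i)) xs (λ i<n → xs≗f (s≤s i<n))))

σ-++ : ∀ xs ys → σ (xs ++ ys) ≡ σ xs ++ σ ys
σ-++ []                 ys = refl
σ-++ (zero ∷ xs)        ys = cong (λ w → 2 ∷ 1 ∷ w) (σ-++ xs ys)
σ-++ (suc zero ∷ xs)    ys = cong (2 ∷_) (σ-++ xs ys)
σ-++ (suc (suc _) ∷ xs) ys = cong (λ w → 2 ∷ 1 ∷ w) (σ-++ xs ys)

σ-concat-replicate : ∀ n w → σ (concat (replicate n w)) ≡ concat (replicate n (σ w))
σ-concat-replicate zero    w = refl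
σ-concat-replicate (suc n) w =
  trans (σ-++ w _) (cong (σ w ++_) (σ-concat-replicate n w))

concat-replicate-[x] : ∀ n (x : ℕ) → concat (replicate n (x ∷ [])) ≡ replicate n x
concat-replicate-[x] zero    x = refl
concat-replicate-[x] (suc n) x = cong (x ∷_) (concat-replicate-[x] n x)

σ-Is12 : ∀ xs → All Is12 (σ xs)
σ-Is12 []                 = []
σ-Is12 (zero ∷ xs)        = inj₂ refl ∷ inj₁ refl ∷ σ-Is12 xs
σ-Is12 (suc zero ∷ xs)    = inj₂ refl ∷ σ-Is12 xs
σ-Is12 (suc (suc _) ∷ xs) = inj₂ refl ∷ inj₁ refl ∷ σ-Is12 xs

length-σ : ∀ xs → length xs ≤ length (σ xs)
length-σ []                 = z≤n
length-σ (zero ∷ xs)        = s≤s (m≤n⇒m≤1+n (length-σ xs))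
length-σ (suc zero ∷ xs)    = s≤s (length-σ xs)
length-σ (suc (suc _) ∷ xs) = s≤s (m≤n⇒m≤1+n (length-σ xs))

σ-head : ∀ x xs → ∃[ ys ] σ (x ∷ xs) ≡ 2 ∷ ys
σ-head zero          xs = _ , refl
σ-head (suc zero)    xs = _ , refl
σ-head (suc (suc _)) xs = _ , refl

-- The images σ 1 = 2 and σ 2 = 2,1 have digit sum one more than the letter.
sum-σ : ∀ {xs} → All Is12 xs → sum (σ xs) ≡ length xs + sum xs
sum-σ []                 = refl
sum-σ {xs = _ ∷ xs} (inj₁ refl ∷ p) =
  trans (cong (2 +_) (sum-σ p)) (cong suc (x∙yz≈y∙xz 1 (length xs) (sum xs)))
sum-σ {xs = _ ∷ xs} (inj₂ refl ∷ p) =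
  trans (cong (3 +_) (sum-σ p)) (cong suc (x∙yz≈y∙xz 2 (length xs) (sum xs)))

σ-split : ∀ xs r → nth (σ xs) r ≡ 2 →
          ∃[ ys ] ∃[ x ] ∃[ zs ] xs ≡ ys ++ x ∷ zs × r ≡ length (σ ys)
σ-split []                 r             ()
σ-split (x ∷ xs)           zero          _  = [] , x , xs , refl , refl
σ-split (zero ∷ xs)        (suc zero)    ()
σ-split (suc (suc _) ∷ xs) (suc zero)    ()
σ-split (zero ∷ xs)        (suc (suc r)) e with σ-split xs r e
... | ys , x , zs , eq , er = zero ∷ ys , x , zs , cong (zero ∷_) eq , cong (λ n → 2 + n) er
σ-split (suc zero ∷ xs)    (suc r)       e with σ-split xs r e
... | ys , x , zs , eq , er = 1 ∷ ys , x , zs , cong (1 ∷_) eq , cong suc er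
σ-split (suc (suc n) ∷ xs) (suc (suc r)) e with σ-split xs r e
... | ys , x , zs , eq , er = suc (suc n) ∷ ys , x , zs , cong (suc (suc n) ∷_) eq , cong (λ n → 2 + n) er

module _ {f : ℕ → ℕ} (f-increasing : ∀ n → f n < f (suc n)) where

  increasing⇒<-mono : ∀ {m n} → m < n → f m < f n
  increasing⇒<-mono {m} {suc n} m<1+n with m≤n⇒m<n∨m≡n (≤-pred m<1+n)
  ... | inj₁ m<n  = <-trans (increasing⇒<-mono m<n) (f-increasing n)
  ... | inj₂ refl = f-increasing m

  increasing⇒≤-mono : ∀ {m n} → m ≤ n → f m ≤ f n
  increasing⇒≤-mono m≤n with m≤n⇒m<n∨m≡n m≤n
  ... | inj₁ m<n  = <⇒≤ (increasing⇒<-mono m<n)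
  ... | inj₂ refl = ≤-refl

  increasing⇒<-reflecting : ∀ {m n} → f m < f n → m < n
  increasing⇒<-reflecting {m} {n} fm<fn with m <? n
  ... | yes m<n = m<n
  ... | no  m≮n = contradiction fm<fn (≤⇒≯ (increasing⇒≤-mono (≮⇒≥ m≮n)))

  increasing⇒injective : ∀ {m n} → f m ≡ f n → m ≡ n
  increasing⇒injective {m} {n} fm≡fn with <-cmp m n
  ... | tri< m<n _ _ = contradiction fm≡fn (<⇒≢ (increasing⇒<-mono m<n))
  ... | tri≈ _ m≡n _ = m≡n
  ... | tri> _ _ n<m = contradiction (sym fm≡fn) (<⇒≢ (increasing⇒<-mono n<m))

  increasing⇒bracket : ∀ x → f 0 ≤ x → ∃[ n ] f n ≤ x × x < f (suc n)
  increasing⇒bracket zero    f0≤0 = 0 , f0≤0 , ≤-<-trans z≤n (f-increasing 0)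
  increasing⇒bracket (suc x) f0≤1+x with m≤n⇒m<n∨m≡n f0≤1+x
  ... | inj₂ f0≡1+x = 0 , f0≤1+x , subst (_< f 1) f0≡1+x (f-increasing 0)
  ... | inj₁ (s≤s f0≤x) with increasing⇒bracket x f0≤x
  ...   | n , fn≤x , x<f[1+n] with m≤n⇒m<n∨m≡n x<f[1+n]
  ...     | inj₁ 1+x<f[1+n] = n , m≤n⇒m≤1+n fn≤x , 1+x<f[1+n]
  ...     | inj₂ 1+x≡f[1+n] =
              suc n , ≤-reflexive (sym 1+x≡f[1+n]) ,
              subst (_< f (2 + n)) (sym 1+x≡f[1+n]) (f-increasing (suc n))

module _ {k : ℕ} where

  Move-source : ∀ {x y u v} → Move k x y u v → k < x + y
  Move-source (left  k<x+y _)     = k<x+y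
  Move-source (down  k<x+y _)     = k<x+y
  Move-source (diag  k<x+y _ _ _) = k<x+y

  Move-decreasing : ∀ {x y u v} → Move k x y u v → u + v < x + y
  Move-decreasing {y = y} (left _ u<x) = +-monoˡ-< y u<x
  Move-decreasing {x = x} (down _ v<y) = +-monoʳ-< x v<y
  Move-decreasing {x = x} {y} (diag {t = t} _ 1≤t t≤x _) =
    +-mono-<-≤ (∸-monoʳ-< 1≤t t≤x) (m∸n≤m y t)

  Move-swap : ∀ {x y u v} → Move k x y u v → Move k y x v u
  Move-swap {x} {y} (left  k<x+y u<x) = down (subst (k <_) (+-comm x y) k<x+y) u<x
  Move-swap {x} {y} (down  k<x+y v<y) = left (subst (k <_) (+-comm x y) k<x+y) v<y
  Move-swap {x} {y} (diag  k<x+y 1≤t t≤x t≤y) = diag (subst (k <_) (+-comm x y) k<x+y) 1≤t t≤y t≤x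

  diag⁺ : ∀ {x y u v t} → k < x + y → 1 ≤ t → u + t ≡ x → v + t ≡ y → Move k x y u v
  diag⁺ {u = u} {v} {t} k<x+y 1≤t refl refl =
    subst₂ (Move k (u + t) (v + t)) (m+n∸n≡m u t) (m+n∸n≡m v t)
           (diag k<x+y 1≤t (m≤n+m t u) (m≤n+m t v))

  IsP⇒¬IsN : ∀ {x y} → IsP k x y → ¬ IsN k x y
  IsP⇒¬IsN (allMovesToN toN) (moveToP u v m p) = IsP⇒¬IsN p (toN u v m)

Independent : ℕ → (ℕ → ℕ → Set) → Set
Independent k Q = ∀ {x y u v} → Q x y → Move k x y u v → ¬ Q u v

MovesInto : ℕ → (ℕ → ℕ → Set) → ℕ → ℕ → Set
MovesInto k Q x y = ∃[ u ] ∃[ v ] Move k x y u v × Q u v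

Absorbing : ℕ → (ℕ → ℕ → Set) → Set
Absorbing k Q = ∀ x y → Q x y ⊎ MovesInto k Q x y

IsP⇔kernel : ∀ {k} {Q : ℕ → ℕ → Set} → Independent k Q → Absorbing k Q →
             ∀ x y → IsP k x y ⇔ Q x y
IsP⇔kernel {k} {Q} independent absorbing x y = mk⇔ IsP⇒Q (Q⇒IsP (<-wellFounded _))
  where
  Q⇒IsP : ∀ {x y} → Acc _<_ (x + y) → Q x y → IsP k x y
  Q⇒IsP {x} {y} (acc rec) q = allMovesToN escape
    where
    escape : ∀ u v → Move k x y u v → IsN k u v
    escape u v m with absorbing u v
    ... | inj₁ q′                  = contradiction q′ (independent q m)
    ... | inj₂ (u′ , v′ , m′ , q′) =
          moveToP u′ v′ m′ (Q⇒IsP (rec (<-trans (Move-decreasing m′) (Move-decreasing m))) q′)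

  IsP⇒Q : IsP k x y → Q x y
  IsP⇒Q p with absorbing x y
  ... | inj₁ q               = q
  ... | inj₂ (u , v , m , q) = contradiction (moveToP u v m (Q⇒IsP (<-wellFounded _) q)) (IsP⇒¬IsN p)

module Word (k : ℕ) where

  ones : List ℕ
  ones = replicate k 1

  prefix-suc : ∀ M → prefix k (suc M) ≡ ones ++ σ (prefix k M)
  prefix-suc zero    = trans (concat-replicate-[x] k 1) (sym (++-identityʳ ones))
  prefix-suc (suc M) = begin
    prefix k (suc M) ++ block k (suc M)
      ≡⟨ cong₂ _++_ (prefix-suc M) (sym (σ-concat-replicate k (Cw M))) ⟩
    (ones ++ σ (prefix k M)) ++ σ (block k M)
      ≡⟨ ++-assoc ones _ _ ⟩
    ones ++ (σ (prefix k M) ++ σ (block k M))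
      ≡⟨ cong (ones ++_) (sym (σ-++ (prefix k M) _)) ⟩
    ones ++ σ (prefix k (suc M))
      ∎
    where open ≡-Reasoning

  prefix-Is12 : ∀ M → All Is12 (prefix k M)
  prefix-Is12 zero = []
  prefix-Is12 (suc M) rewrite prefix-suc M = ++⁺ (replicate⁺ k (inj₁ refl)) (σ-Is12 _)

  prefix-mono : ∀ {M N} → M ≤ N → ∃[ R ] prefix k M ++ R ≡ prefix k N
  prefix-mono {N = zero} z≤n = [] , refl
  prefix-mono {M} {suc N} M≤1+N with m≤n⇒m<n∨m≡n M≤1+N
  ... | inj₂ refl      = [] , ++-identityʳ _
  ... | inj₁ (s≤s M≤N) with prefix-mono M≤N
  ...   | R , eq = R ++ block k N ,
                   trans (sym (++-assoc (prefix k M) R _)) (cong (_++ block k N) eq)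

  γ : ℕ → ℕ
  γ i = c k (suc i)

  α : ℕ → ℕ
  α i = a k (suc i)

  β : ℕ → ℕ
  β i = b k (suc i)

  γ≡nth-1ᵏσ : ∀ i → γ i ≡ nth (ones ++ σ (prefix k i)) i
  γ≡nth-1ᵏσ i = cong (λ w → nth w i) (prefix-suc i)

  IsPrefix : List ℕ → Set
  IsPrefix W = ∃[ M ] ∃[ R ] W ++ R ≡ prefix k M

  IsPrefix-++ˡ : ∀ W {V} → IsPrefix (W ++ V) → IsPrefix W
  IsPrefix-++ˡ W {V} (M , R , eq) = M , V ++ R , trans (sym (++-assoc W V R)) eq

  IsPrefix-σ : ∀ {W} → IsPrefix W → IsPrefix (ones ++ σ W)
  IsPrefix-σ {W} (M , R , eq) = suc M , σ R , (begin
    (ones ++ σ W) ++ σ R   ≡⟨ ++-assoc ones _ _ ⟩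
    ones ++ (σ W ++ σ R)   ≡⟨ cong (ones ++_) (sym (σ-++ W R)) ⟩
    ones ++ σ (W ++ R)     ≡⟨ cong (λ w → ones ++ σ w) eq ⟩
    ones ++ σ (prefix k M) ≡⟨ sym (prefix-suc M) ⟩
    prefix k (suc M)       ∎)
    where open ≡-Reasoning

  IsPrefix-Is12 : ∀ {W} → IsPrefix W → All Is12 W
  IsPrefix-Is12 {W} (M , R , eq) = ++⁻ˡ W (subst (All Is12) (sym eq) (prefix-Is12 M))

  α-suc : ∀ i → α (suc i) ≡ α i + γ i
  α-suc i = sym (+-assoc (suc k) (sumTo (c k) i) (γ i))

  β≡α+ : ∀ i → β i ≡ α i + (suc k + i)
  β≡α+ i = trans (cong (2 + 2 * k +_) (sumTo-suc (c k) i)) (rearrange k (sumTo (c k) i) i)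
    where
    rearrange : ∀ k s i → 2 + 2 * k + (s + i) ≡ suc k + s + (suc k + i)
    rearrange = solve-∀

module Complementarity (k : ℕ) (1≤k : 1 ≤ k) where
  open Word k

  length-prefix : ∀ M → M ≤ length (prefix k M)
  length-prefix zero    = z≤n
  length-prefix (suc M) rewrite prefix-suc M | length-++ ones {σ (prefix k M)} | length-replicate k {x = 1} =
    +-mono-≤ 1≤k (≤-trans (length-prefix M) (length-σ (prefix k M)))

  prefix-nth : ∀ M {i} → i < length (prefix k M) → nth (prefix k M) i ≡ γ i
  prefix-nth M {i} i<n with ≤-total M (suc i)
  ... | inj₁ M≤1+i with prefix-mono M≤1+i
  ...   | R , eq = trans (sym (nth-++ˡ (prefix k M) R i<n)) (cong (λ w → nth w i) eq)
  prefix-nth M {i} i<n | inj₂ 1+i≤M with prefix-mono 1+i≤M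
  ...   | R , eq = trans (cong (λ w → nth w i) (sym eq)) (nth-++ˡ (prefix k (suc i)) R (length-prefix (suc i)))

  IsPrefix-nth : ∀ {W} → IsPrefix W → ∀ {i} → i < length W → nth W i ≡ γ i
  IsPrefix-nth {W} (M , R , eq) {i} i<n = begin
    nth W i            ≡⟨ sym (nth-++ˡ W R i<n) ⟩
    nth (W ++ R) i     ≡⟨ cong (λ w → nth w i) eq ⟩
    nth (prefix k M) i ≡⟨ prefix-nth M (<-≤-trans i<n |W|≤) ⟩
    γ i                ∎
    where
    open ≡-Reasoning
    |W|≤ : length W ≤ length (prefix k M)
    |W|≤ = ≤-trans (m≤m+n _ _) (≤-reflexive (trans (sym (length-++ W)) (cong length eq)))

  IsPrefix-letter : ∀ W {x R} → IsPrefix (W ++ x ∷ R) → γ (length W) ≡ x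
  IsPrefix-letter W {x} {R} p = trans (sym (IsPrefix-nth p |W|<)) (nth-length W x R)
    where
    |W|< : length W < length (W ++ x ∷ R)
    |W|< = <-≤-trans (m<m+n (length W) (s≤s z≤n)) (≤-reflexive (sym (length-++ W)))

  γ-Is12 : ∀ i → Is12 (γ i)
  γ-Is12 i = All-nth (prefix-Is12 (suc i)) (length-prefix (suc i))

  α-prefix : ∀ {W} → IsPrefix W → α (length W) ≡ suc k + sum W
  α-prefix {W} p = cong (suc k +_) (sumTo-nth (c k) W (IsPrefix-nth p))

  -- In c = 1ᵏ σ(c), the image of the letter following A starts at index |1ᵏ σ(A)|.
  σ-prefix-gap : ∀ {A} → IsPrefix A → suc (α (length (ones ++ σ A))) ≡ β (length A)
  σ-prefix-gap {A} p = begin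
    suc (α (length (ones ++ σ A)))     ≡⟨ cong suc (α-prefix (IsPrefix-σ p)) ⟩
    suc (suc k + sum (ones ++ σ A))    ≡⟨ cong (λ s → 2 + k + s) (sum-++ ones (σ A)) ⟩
    2 + k + (sum ones + sum (σ A))     ≡⟨ cong₂ (λ s t → 2 + k + (s + t)) sum-ones sum-σA ⟩
    2 + k + (k + (length A + sum A))   ≡⟨ rearrange k (length A) (sum A) ⟩
    suc k + sum A + (suc k + length A) ≡⟨ cong (_+ (suc k + length A)) (sym (α-prefix p)) ⟩
    α (length A) + (suc k + length A)  ≡⟨ sym (β≡α+ (length A)) ⟩
    β (length A)                       ∎
    where
    open ≡-Reasoning
    sum-ones : sum ones ≡ k
    sum-ones = trans (sum-replicate k 1) (*-identityʳ k)
    sum-σA : sum (σ A) ≡ length A + sum A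
    sum-σA = sum-σ (IsPrefix-Is12 p)
    rearrange : ∀ k l s → 2 + k + (k + (l + s)) ≡ suc k + s + (suc k + l)
    rearrange = solve-∀

  β-is-gap : ∀ j → ∃[ i ] γ i ≡ 2 × suc (α i) ≡ β j
  β-is-gap j with split-at (prefix k (suc j)) (length-prefix (suc j))
  ... | A , x , B , eq , refl with σ-head x B
  ...   | R , σxB≡2∷R = length (ones ++ σ A) , IsPrefix-letter (ones ++ σ A) 1ᵏσA2R , σ-prefix-gap pA
    where
    pAxB : IsPrefix (A ++ x ∷ B)
    pAxB = suc (length A) , [] , trans (++-identityʳ _) eq
    pA : IsPrefix A
    pA = IsPrefix-++ˡ A pAxB
    1ᵏσA2R : IsPrefix ((ones ++ σ A) ++ 2 ∷ R)
    1ᵏσA2R = subst IsPrefix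
      (trans (cong (ones ++_) (trans (σ-++ A (x ∷ B)) (cong (σ A ++_) σxB≡2∷R)))
             (sym (++-assoc ones (σ A) _)))
      (IsPrefix-σ pAxB)

  gap-is-β : ∀ i → γ i ≡ 2 → ∃[ j ] suc (α i) ≡ β j
  gap-is-β i γi≡2 with i <? length ones
  ... | yes i<k = contradiction (trans (sym γi≡1) γi≡2) λ ()
    where
    γi≡1 : γ i ≡ 1
    γi≡1 = trans (γ≡nth-1ᵏσ i) (trans (nth-++ˡ ones _ i<k) (All-nth (replicate⁺ {P = _≡ 1} k refl) i<k))
  ... | no i≮k with m≤n⇒∃[o]m+o≡n (≮⇒≥ i≮k)
  ...   | r , refl with σ-split (prefix k (length ones + r)) r
                          (trans (sym (nth-++ʳ ones _ r)) (trans (sym (γ≡nth-1ᵏσ (length ones + r))) γi≡2))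
  ...     | A , x , B , eq , refl =
            length A , subst (λ n → suc (α n) ≡ β (length A)) (length-++ ones)
                             (σ-prefix-gap (length ones + length (σ A) , x ∷ B , sym eq))

  γ-positive : ∀ i → 1 ≤ γ i
  γ-positive i with γ-Is12 i
  ... | inj₁ γi≡1 = ≤-reflexive (sym γi≡1)
  ... | inj₂ γi≡2 = subst (1 ≤_) (sym γi≡2) (s≤s z≤n)

  α-increasing : ∀ i → α i < α (suc i)
  α-increasing i = subst (α i <_) (sym (α-suc i)) (m<m+n (α i) (γ-positive i))

  β-increasing : ∀ i → β i < β (suc i)
  β-increasing i = subst (β i <_) (+-assoc (2 + 2 * k) (sumTo (d k) i) (d k (suc i))) (m<m+n (β i) (s≤s z≤n))

  α-injective : ∀ {i j} → α i ≡ α j → i ≡ j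
  α-injective {i} {j} = increasing⇒injective α-increasing {i} {j}

  β-injective : ∀ {i j} → β i ≡ β j → i ≡ j
  β-injective {i} {j} = increasing⇒injective β-increasing {i} {j}

  k<α : ∀ i → k < α i
  k<α i = m≤m+n (suc k) _

  α<β : ∀ i → α i < β i
  α<β i = subst (α i <_) (sym (β≡α+ i)) (m<m+n (α i) (s≤s z≤n))

  α≢β : ∀ i j → α i ≢ β j
  α≢β i j αi≡βj with β-is-gap j
  ... | p , γp≡2 , 1+αp≡βj =
        <⇒≱ αi<α[1+p]
            (increasing⇒≤-mono α-increasing (increasing⇒<-reflecting α-increasing {p} {i} αp<αi))
    where
    αi≡1+αp : α i ≡ suc (α p)
    αi≡1+αp = trans αi≡βj (sym 1+αp≡βj)
    αp<αi : α p < α i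
    αp<αi = subst (α p <_) (sym αi≡1+αp) (n<1+n (α p))
    αi<α[1+p] : α i < α (suc p)
    αi<α[1+p] = subst₂ _<_ (sym αi≡1+αp) (sym (trans (α-suc p) (cong (α p +_) γp≡2)))
                       (≤-reflexive (+-comm 2 (α p)))

  α-or-β : ∀ {x} → k < x → (∃[ i ] x ≡ α i) ⊎ (∃[ j ] x ≡ β j)
  α-or-β {x} k<x with increasing⇒bracket α-increasing x (≤-trans (≤-reflexive (+-identityʳ (suc k))) k<x)
  ... | i , αi≤x , x<α[1+i] with m≤n⇒∃[o]m+o≡n αi≤x
  ...   | e , refl = inside-step e (+-cancelˡ-< (α i) e (γ i) (subst (α i + e <_) (α-suc i) x<α[1+i]))
    where
    inside-step : ∀ o → o < γ i → (∃[ i′ ] α i + o ≡ α i′) ⊎ (∃[ j ] α i + o ≡ β j)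
    inside-step zero    _      = inj₁ (i , +-identityʳ (α i))
    inside-step (suc o) 1+o<γi with γ-Is12 i
    ... | inj₁ γi≡1 = contradiction (subst (suc o <_) γi≡1 1+o<γi) λ { (s≤s ()) }
    ... | inj₂ γi≡2 with subst (suc o <_) γi≡2 1+o<γi
    ...   | s≤s (s≤s z≤n) = inj₂ (Product.map₂ (trans (+-comm (α i) 1)) (gap-is-β i γi≡2))

module Game (k : ℕ) (1≤k : 1 ≤ k) where
  open Word k
  open Complementarity k 1≤k

  Pair : ℕ → ℕ → Set
  Pair x y = ∃[ i ] x ≡ α i × y ≡ β i

  Pk′ : ℕ → ℕ → Set
  Pk′ x y = x + y ≤ k ⊎ Pair y x ⊎ Pair x y

  Pk′⇔Pk : ∀ {x y} → Pk′ x y ⇔ Pk k x y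
  Pk′⇔Pk {x} {y} = mk⇔ to from
    where
    to : Pk′ x y → Pk k x y
    to (inj₁ x+y≤k)                   = inj₁ x+y≤k
    to (inj₂ (inj₁ (i , y≡α , x≡β))) = inj₂ (inj₁ (suc i , s≤s z≤n , x≡β , y≡α))
    to (inj₂ (inj₂ (i , x≡α , y≡β))) = inj₂ (inj₂ (suc i , s≤s z≤n , x≡α , y≡β))
    from : Pk k x y → Pk′ x y
    from (inj₁ x+y≤k)                         = inj₁ x+y≤k
    from (inj₂ (inj₁ (suc i , _ , x≡β , y≡α))) = inj₂ (inj₁ (i , y≡α , x≡β))
    from (inj₂ (inj₂ (suc i , _ , x≡α , y≡β))) = inj₂ (inj₂ (i , x≡α , y≡β))
    from (inj₂ (inj₁ (zero , () , _)))
    from (inj₂ (inj₂ (zero , () , _)))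

  Pk′-swap : ∀ {x y} → Pk′ x y → Pk′ y x
  Pk′-swap {x} {y} = Sum.map (subst (_≤ k) (+-comm x y)) Sum.swap

  β∸t≡α∸t+ : ∀ i {t} → t ≤ α i → β i ∸ t ≡ (α i ∸ t) + (suc k + i)
  β∸t≡α∸t+ i {t} t≤α = trans (cong (_∸ t) (β≡α+ i)) (+-∸-comm (suc k + i) t≤α)

  -- Moving along a row or column keeps one coordinate, while a diagonal move keeps
  -- the difference y - x, and β i - α i = suc k + i determines i.
  pair-independent : ∀ i {u v} → Move k (α i) (β i) u v → ¬ Pk′ u v
  pair-independent i (left _ u<α) (inj₁ u+β≤k) =
    <⇒≱ (<-trans (k<α i) (α<β i)) (≤-trans (m≤n+m _ _) u+β≤k)
  pair-independent i (left _ u<α) (inj₂ (inj₁ (j , βi≡αj , refl))) = α≢β j i (sym βi≡αj)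
  pair-independent i (left _ u<α) (inj₂ (inj₂ (j , refl , βi≡βj))) =
    <⇒≢ u<α (cong α (sym (β-injective {i} {j} βi≡βj)))
  pair-independent i (down _ v<β) (inj₁ α+v≤k) = <⇒≱ (k<α i) (≤-trans (m≤m+n _ _) α+v≤k)
  pair-independent i (down _ v<β) (inj₂ (inj₁ (j , refl , αi≡βj))) = α≢β i j αi≡βj
  pair-independent i (down _ v<β) (inj₂ (inj₂ (j , αi≡αj , refl))) =
    <⇒≢ v<β (cong β (sym (α-injective {i} {j} αi≡αj)))
  pair-independent i (diag {t = t} _ _ t≤α _) (inj₁ sum≤k) =
    <⇒≱ (<-≤-trans k<β∸t (m≤n+m (β i ∸ t) (α i ∸ t))) sum≤k
    where
    k<β∸t : k < β i ∸ t
    k<β∸t = subst (k <_) (sym (β∸t≡α∸t+ i t≤α)) (≤-trans (m≤m+n (suc k) i) (m≤n+m _ (α i ∸ t)))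
  pair-independent i (diag {t = t} _ _ _ _) (inj₂ (inj₁ (j , β∸t≡αj , α∸t≡βj))) =
    <⇒≱ (α<β j) (subst₂ _≤_ α∸t≡βj β∸t≡αj (∸-monoˡ-≤ t (<⇒≤ (α<β i))))
  pair-independent i (diag {t = t} _ 1≤t t≤α _) (inj₂ (inj₂ (j , α∸t≡αj , β∸t≡βj))) =
    <⇒≢ (∸-monoʳ-< 1≤t t≤α) (trans α∸t≡αj (cong α (sym i≡j)))
    where
    i≡j : i ≡ j
    i≡j = +-cancelˡ-≡ (suc k) i j (+-cancelˡ-≡ (α j) _ _ (begin
      α j + (suc k + i)       ≡⟨ cong (_+ (suc k + i)) α∸t≡αj ⟨
      (α i ∸ t) + (suc k + i) ≡⟨ β∸t≡α∸t+ i t≤α ⟨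
      β i ∸ t                 ≡⟨ β∸t≡βj ⟩
      β j                     ≡⟨ β≡α+ j ⟩
      α j + (suc k + j)       ∎))
      where open ≡-Reasoning

  Pk′-independent : Independent k Pk′
  Pk′-independent (inj₁ x+y≤k)                   m _ = <⇒≱ (Move-source m) x+y≤k
  Pk′-independent (inj₂ (inj₂ (i , refl , refl))) m   = pair-independent i m
  Pk′-independent (inj₂ (inj₁ (i , refl , refl))) m q = pair-independent i (Move-swap m) (Pk′-swap q)

  Escape : ℕ → ℕ → Set
  Escape x y = Pk′ x y ⊎ MovesInto k Pk′ x y

  -- Writing y = α i + δ, there is a diagonal move onto the pair j exactly when
  -- δ = suc k + j with j < i.
  escape-from-α : ∀ i {y} → k < α i + y → α i ≤ y → Escape (α i) y
  escape-from-α i k<x+y αi≤y with m≤n⇒∃[o]m+o≡n αi≤y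
  ... | δ , refl with δ ≤? k
  ... | yes δ≤k =
        inj₂ (0 , δ , diag⁺ k<x+y (≤-trans (s≤s z≤n) (k<α i)) refl (+-comm δ (α i)) , inj₁ δ≤k)
  ... | no  δ≰k with m≤n⇒∃[o]m+o≡n (≰⇒> δ≰k)
  ...   | j , refl with <-cmp j i
  ...     | tri≈ _ refl _ = inj₁ (inj₂ (inj₂ (i , refl , sym (β≡α+ i))))
  ...     | tri> _ _ i<j  = inj₂ (α i , β i , down k<x+y βi<y , inj₂ (inj₂ (i , refl , refl)))
    where
    βi<y : β i < α i + (suc k + j)
    βi<y = subst (_< α i + (suc k + j)) (sym (β≡α+ i)) (+-monoʳ-< (α i) (+-monoʳ-< (suc k) i<j))
  ...     | tri< j<i _ _  =
            inj₂ (α j , β j , diag⁺ k<x+y (m<n⇒0<n∸m αj<αi) αj+t≡αi βj+t≡y ,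
                  inj₂ (inj₂ (j , refl , refl)))
    where
    αj<αi : α j < α i
    αj<αi = increasing⇒<-mono α-increasing j<i
    αj+t≡αi : α j + (α i ∸ α j) ≡ α i
    αj+t≡αi = m+[n∸m]≡n (<⇒≤ αj<αi)
    βj+t≡y : β j + (α i ∸ α j) ≡ α i + (suc k + j)
    βj+t≡y = begin
      β j + (α i ∸ α j)               ≡⟨ cong (_+ (α i ∸ α j)) (β≡α+ j) ⟩
      α j + (suc k + j) + (α i ∸ α j) ≡⟨ xy∙z≈xz∙y (α j) _ _ ⟩
      α j + (α i ∸ α j) + (suc k + j) ≡⟨ cong (_+ (suc k + j)) αj+t≡αi ⟩
      α i + (suc k + j)               ∎
      where open ≡-Reasoning

  escape-≤ : ∀ {x y} → k < x + y → x ≤ y → Escape x y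
  escape-≤ {x} {y} k<x+y x≤y with x ≤? k
  ... | yes x≤k = inj₂ (x , k ∸ x , down k<x+y k∸x<y , inj₁ (≤-reflexive (m+[n∸m]≡n x≤k)))
    where
    k∸x<y : k ∸ x < y
    k∸x<y = +-cancelˡ-< x (k ∸ x) y (subst (_< x + y) (sym (m+[n∸m]≡n x≤k)) k<x+y)
  ... | no x≰k with α-or-β (≰⇒> x≰k)
  ...   | inj₁ (i , refl) = escape-from-α i k<x+y x≤y
  ...   | inj₂ (j , refl) =
          inj₂ (β j , α j , down k<x+y (<-≤-trans (α<β j) x≤y) , inj₂ (inj₁ (j , refl , refl)))

  Pk′-absorbing : Absorbing k Pk′
  Pk′-absorbing x y with x + y ≤? k
  ... | yes x+y≤k = inj₁ (inj₁ x+y≤k)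
  ... | no  x+y≰k with ≤-total x y
  ...   | inj₁ x≤y = escape-≤ (≰⇒> x+y≰k) x≤y
  ...   | inj₂ y≤x =
          Sum.map Pk′-swap swap-escape (escape-≤ (subst (k <_) (+-comm x y) (≰⇒> x+y≰k)) y≤x)
    where
    swap-escape : MovesInto k Pk′ y x → MovesInto k Pk′ x y
    swap-escape (u , v , m , q) = v , u , Move-swap m , Pk′-swap q

theorem5p3 : (k : ℕ) → 1 ≤ k → (x y : ℕ) → IsP k x y ⇔ Pk k x y
theorem5p3 k 1≤k x y = ⇔-trans (IsP⇔kernel Pk′-independent Pk′-absorbing x y) Pk′⇔Pk
  where open Game k 1≤k
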